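{- (a) For all integers $i \geq 0$, $f_{3,0}\!\left(\frac{65\cdot 4^{i+1}+1}{3}\right) = 55\cdot 3^i$. (b) For all integers $i \geq 0$, $f_{3,0}(2\cdot 4^i) = 2\cdot 3^i$.
   Context: Let $t(n)$ be the number of $1$'s in the base-$2$ representation of $n$, taken modulo $2$. Define $f_{3,0}(n) = \sum_{0 \leq i < n} (-1)^{t(3i)}$ for $n \geq 0$. -}

module Defs where

open import Data.Nat using (ℕ; zero; suc; _+_; _*_)
open import Data.Nat.DivMod using (_/_; _%_)
open import Data.Integer using (ℤ; +_; -_) renaming (_+_ to _+ℤ_)

-- Number of 1's in the base-2 representation of n, computed with fuel
-- (fuel ≥ number of binary digits; fuel = n suffices).
popcountAux : ℕ → ℕ → ℕ
popcountAux zero    n = 0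
popcountAux (suc k) n = n % 2 + popcountAux k (n / 2)

popcount : ℕ → ℕ
popcount n = popcountAux n n

t : ℕ → ℕ
t n = popcount n % 2

sign : ℕ → ℤ
sign n with t n
... | zero = + 1
... | suc _ = - (+ 1)

f30 : ℕ → ℤ
f30 zero    = + 0
f30 (suc n) = f30 n +ℤ sign (3 * n)

module Submission where

open import Defs
open import Data.Nat using (ℕ; zero; suc; _+_; _*_; _^_; _%_; _≤_; _<_; z≤n; s≤s; s≤s⁻¹)
open import Data.Nat.Properties using (≤-refl; <-≤-trans; *-comm; *-assoc)
open import Data.Nat.DivMod
  using (_/_; m≡m%n+[m/n]*n; m%n<n; m/n<m; m*n%n≡0; m*n/n≡m; [m+kn]%n≡m%n; +-distrib-/-∣ʳ)
open import Data.Nat.Divisibility using (n∣m*n)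
open import Data.Integer using (ℤ; +_; 0ℤ; -1ℤ; -_) renaming (_+_ to _+ℤ_; _*_ to _*ℤ_; _^_ to _^ℤ_)
open import Data.Integer.Properties
  using ( ^-distribˡ-+-*; +-identityˡ; +-identityʳ; +-inverseʳ; -1*i≡-i; neg-involutive
        ; *-identityʳ; *-distribˡ-+; pos-*)
open import Data.List using (_∷_; [])
open import Data.Product using (_×_; _,_)
open import Relation.Nullary using (contradiction)
open import Relation.Binary.PropositionalEquality
  using (_≡_; refl; sym; trans; cong; cong₂; subst; module ≡-Reasoning)
import Data.Nat.Tactic.RingSolver as ℕ-Solver
import Data.Integer.Tactic.RingSolver as ℤ-Solver

open ≡-Reasoning

-- Write s n = (-1)^{t(n)} and T m = Σ_{j<m} s j.  Since s (2n) = s n and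
-- s (2n+1) = - s n, the Thue–Morse sum T vanishes at every even m, and
-- comparing the block 12n, 12n+3, 12n+6, 12n+9 with the block 3n, 3n+1, 3n+2
-- gives f(4n) + T(3n) = 3 f(n).  At 8n and 8n+3 the correction term T is 0
-- or cancels the last summand of f, so f(8n) = 3 f(2n) and f(8n+3) = 3 f(2n+1).
-- Both families of arguments in the theorem are iterates of these maps,
-- starting from f(2) = 2 and f(87) = 55.

popcountAux-zero : ∀ k → popcountAux k 0 ≡ 0
popcountAux-zero zero    = refl
popcountAux-zero (suc k) = popcountAux-zero k

half≤pred : ∀ {n k} → n ≤ suc k → n / 2 ≤ k
half≤pred {zero}  _   = z≤n
half≤pred {suc m} n≤k = s≤s⁻¹ (<-≤-trans (m/n<m (suc m) 2 (s≤s (s≤s z≤n))) n≤k)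

popcountAux-fuel : ∀ k k′ {n} → n ≤ k → n ≤ k′ → popcountAux k n ≡ popcountAux k′ n
popcountAux-fuel zero     k′       z≤n _   = sym (popcountAux-zero k′)
popcountAux-fuel (suc k)  zero     _   z≤n = popcountAux-zero (suc k)
popcountAux-fuel (suc k)  (suc k′) {n} p q =
  cong (_+_ (n % 2)) (popcountAux-fuel k k′ (half≤pred p) (half≤pred q))

popcount-unfold : ∀ n → popcount n ≡ n % 2 + popcount (n / 2)
popcount-unfold zero    = refl
popcount-unfold (suc p) =
  cong (_+_ (suc p % 2)) (popcountAux-fuel p (suc p / 2) (half≤pred ≤-refl) ≤-refl)

popcount-double : ∀ n → popcount (n * 2) ≡ popcount n
popcount-double n = trans (popcount-unfold (n * 2))
  (cong₂ _+_ (m*n%n≡0 n 2) (cong popcount (m*n/n≡m n 2)))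

popcount-double+1 : ∀ n → popcount (suc (n * 2)) ≡ suc (popcount n)
popcount-double+1 n = trans (popcount-unfold (suc (n * 2)))
  (cong₂ _+_ ([m+kn]%n≡m%n 1 n 2)
             (cong popcount (trans (+-distrib-/-∣ʳ 1 (n∣m*n n {2})) (m*n/n≡m n 2))))

-1^[m*2]≡1 : ∀ m → -1ℤ ^ℤ (m * 2) ≡ + 1
-1^[m*2]≡1 zero    = refl
-1^[m*2]≡1 (suc m) = cong (λ x → -1ℤ *ℤ (-1ℤ *ℤ x)) (-1^[m*2]≡1 m)

-1^k≡-1^[k%2] : ∀ k → -1ℤ ^ℤ k ≡ -1ℤ ^ℤ (k % 2)
-1^k≡-1^[k%2] k = begin
  -1ℤ ^ℤ k                                  ≡⟨ cong (-1ℤ ^ℤ_) (m≡m%n+[m/n]*n k 2) ⟩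
  -1ℤ ^ℤ (k % 2 + k / 2 * 2)                ≡⟨ ^-distribˡ-+-* -1ℤ (k % 2) (k / 2 * 2) ⟩
  -1ℤ ^ℤ (k % 2) *ℤ -1ℤ ^ℤ (k / 2 * 2)      ≡⟨ cong (-1ℤ ^ℤ (k % 2) *ℤ_) (-1^[m*2]≡1 (k / 2)) ⟩
  -1ℤ ^ℤ (k % 2) *ℤ + 1                     ≡⟨ *-identityʳ _ ⟩
  -1ℤ ^ℤ (k % 2)                            ∎

sign≡-1^t : ∀ n → sign n ≡ -1ℤ ^ℤ t n
sign≡-1^t n with t n in eq
... | 0           = refl
... | 1           = refl
... | suc (suc _) = contradiction (subst (_< 2) eq (m%n<n (popcount n) 2)) λ { (s≤s (s≤s ())) }

sign≡-1^popcount : ∀ n → sign n ≡ -1ℤ ^ℤ popcount n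
sign≡-1^popcount n = trans (sign≡-1^t n) (sym (-1^k≡-1^[k%2] (popcount n)))

sign-double : ∀ n → sign (n * 2) ≡ sign n
sign-double n = begin
  sign (n * 2)                 ≡⟨ sign≡-1^popcount (n * 2) ⟩
  -1ℤ ^ℤ popcount (n * 2)      ≡⟨ cong (-1ℤ ^ℤ_) (popcount-double n) ⟩
  -1ℤ ^ℤ popcount n            ≡⟨ sign≡-1^popcount n ⟨
  sign n                       ∎

sign-double+1 : ∀ n → sign (suc (n * 2)) ≡ - sign n
sign-double+1 n = begin
  sign (suc (n * 2))            ≡⟨ sign≡-1^popcount (suc (n * 2)) ⟩
  -1ℤ ^ℤ popcount (suc (n * 2)) ≡⟨ cong (-1ℤ ^ℤ_) (popcount-double+1 n) ⟩
  -1ℤ *ℤ -1ℤ ^ℤ popcount n      ≡⟨ -1*i≡-i _ ⟩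
  - -1ℤ ^ℤ popcount n           ≡⟨ cong -_ (sign≡-1^popcount n) ⟨
  - sign n                      ∎

thueMorseSum : ℕ → ℤ
thueMorseSum zero    = 0ℤ
thueMorseSum (suc m) = thueMorseSum m +ℤ sign m

thueMorseSum-even : ∀ k → thueMorseSum (k * 2) ≡ 0ℤ
thueMorseSum-even zero    = refl
thueMorseSum-even (suc k) = begin
  thueMorseSum (k * 2) +ℤ sign (k * 2) +ℤ sign (suc (k * 2))
    ≡⟨ cong₂ (λ T s → T +ℤ sign (k * 2) +ℤ s) (thueMorseSum-even k) (sign-double+1 k) ⟩
  0ℤ +ℤ sign (k * 2) +ℤ - sign k
    ≡⟨ cong (λ s → 0ℤ +ℤ s +ℤ - sign k) (sign-double k) ⟩
  0ℤ +ℤ sign k +ℤ - sign k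
    ≡⟨ cong (_+ℤ - sign k) (+-identityˡ (sign k)) ⟩
  sign k +ℤ - sign k
    ≡⟨ +-inverseʳ (sign k) ⟩
  0ℤ ∎

sign-block : ∀ n → sign (3 * (n * 4)) +ℤ sign (3 * (1 + n * 4)) +ℤ sign (3 * (2 + n * 4))
                     +ℤ sign (3 * (3 + n * 4)) +ℤ (sign (n * 3) +ℤ sign (1 + n * 3) +ℤ sign (2 + n * 3))
                   ≡ + 3 *ℤ sign (n * 3)
sign-block n = collect r0 r1 r2 r3
  where
  collect : ∀ {a b c d x y z} → a ≡ x → b ≡ x → c ≡ - y → d ≡ - z →
            a +ℤ b +ℤ c +ℤ d +ℤ (x +ℤ y +ℤ z) ≡ + 3 *ℤ x
  collect {x = x} {y} {z} refl refl refl refl = ℤ-Solver.solve (x ∷ y ∷ z ∷ [])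
  r0 : sign (3 * (n * 4)) ≡ sign (n * 3)
  r0 = begin
    sign (3 * (n * 4))                 ≡⟨ cong sign index ⟩
    sign (n * 3 * 2 * 2)               ≡⟨ sign-double (n * 3 * 2) ⟩
    sign (n * 3 * 2)                   ≡⟨ sign-double (n * 3) ⟩
    sign (n * 3)                       ∎
    where index : 3 * (n * 4) ≡ n * 3 * 2 * 2
          index = ℕ-Solver.solve (n ∷ [])
  r1 : sign (3 * (1 + n * 4)) ≡ sign (n * 3)
  r1 = begin
    sign (3 * (1 + n * 4))             ≡⟨ cong sign index ⟩
    sign (suc (suc (n * 3 * 2) * 2))   ≡⟨ sign-double+1 (suc (n * 3 * 2)) ⟩
    - sign (suc (n * 3 * 2))           ≡⟨ cong -_ (sign-double+1 (n * 3)) ⟩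
    - - sign (n * 3)                   ≡⟨ neg-involutive _ ⟩
    sign (n * 3)                       ∎
    where index : 3 * (1 + n * 4) ≡ suc (suc (n * 3 * 2) * 2)
          index = ℕ-Solver.solve (n ∷ [])
  r2 : sign (3 * (2 + n * 4)) ≡ - sign (1 + n * 3)
  r2 = begin
    sign (3 * (2 + n * 4))             ≡⟨ cong sign index ⟩
    sign (suc (suc (n * 3) * 2) * 2)   ≡⟨ sign-double (suc (suc (n * 3) * 2)) ⟩
    sign (suc (suc (n * 3) * 2))       ≡⟨ sign-double+1 (suc (n * 3)) ⟩
    - sign (1 + n * 3)                 ∎
    where index : 3 * (2 + n * 4) ≡ suc (suc (n * 3) * 2) * 2
          index = ℕ-Solver.solve (n ∷ [])
  r3 : sign (3 * (3 + n * 4)) ≡ - sign (2 + n * 3)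
  r3 = begin
    sign (3 * (3 + n * 4))             ≡⟨ cong sign index ⟩
    sign (suc ((2 + n * 3) * 2 * 2))   ≡⟨ sign-double+1 ((2 + n * 3) * 2) ⟩
    - sign ((2 + n * 3) * 2)           ≡⟨ cong -_ (sign-double (2 + n * 3)) ⟩
    - sign (2 + n * 3)                 ∎
    where index : 3 * (3 + n * 4) ≡ suc ((2 + n * 3) * 2 * 2)
          index = ℕ-Solver.solve (n ∷ [])

-- Multiplying on the right (n * 4, n * 3) makes suc n * 4 reduce to 4 + n * 4, so both
-- sums unfold definitionally by a whole block in the inductive step.
f30-quadruple : ∀ n → f30 (n * 4) +ℤ thueMorseSum (n * 3) ≡ + 3 *ℤ f30 n
f30-quadruple zero    = refl
f30-quadruple (suc n) = begin
  f30 (n * 4) +ℤ a +ℤ b +ℤ c +ℤ d +ℤ (thueMorseSum (n * 3) +ℤ x +ℤ y +ℤ z)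
    ≡⟨ regroup (f30 (n * 4)) (thueMorseSum (n * 3)) a b c d x y z ⟩
  f30 (n * 4) +ℤ thueMorseSum (n * 3) +ℤ (a +ℤ b +ℤ c +ℤ d +ℤ (x +ℤ y +ℤ z))
    ≡⟨ cong₂ _+ℤ_ (f30-quadruple n) (sign-block n) ⟩
  + 3 *ℤ f30 n +ℤ + 3 *ℤ x
    ≡⟨ *-distribˡ-+ (+ 3) (f30 n) x ⟨
  + 3 *ℤ (f30 n +ℤ x)
    ≡⟨ cong (λ m → + 3 *ℤ (f30 n +ℤ sign m)) (*-comm n 3) ⟩
  + 3 *ℤ f30 (suc n) ∎
  where
  a b c d x y z : ℤ
  a = sign (3 * (n * 4))
  b = sign (3 * (1 + n * 4))
  c = sign (3 * (2 + n * 4))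
  d = sign (3 * (3 + n * 4))
  x = sign (n * 3)
  y = sign (1 + n * 3)
  z = sign (2 + n * 3)
  regroup : ∀ F S a b c d x y z → F +ℤ a +ℤ b +ℤ c +ℤ d +ℤ (S +ℤ x +ℤ y +ℤ z)
                                  ≡ F +ℤ S +ℤ (a +ℤ b +ℤ c +ℤ d +ℤ (x +ℤ y +ℤ z))
  regroup = ℤ-Solver.solve-∀

f30-8n : ∀ n → f30 (n * 8) ≡ + 3 *ℤ f30 (n * 2)
f30-8n n = begin
  f30 (n * 8)                                 ≡⟨ cong f30 (*-assoc n 2 4) ⟨
  f30 (n * 2 * 4)                             ≡⟨ +-identityʳ _ ⟨
  f30 (n * 2 * 4) +ℤ 0ℤ                       ≡⟨ cong (f30 (n * 2 * 4) +ℤ_) T[6n]≡0 ⟨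
  f30 (n * 2 * 4) +ℤ thueMorseSum (n * 2 * 3) ≡⟨ f30-quadruple (n * 2) ⟩
  + 3 *ℤ f30 (n * 2)                          ∎
  where
  T[6n]≡0 : thueMorseSum (n * 2 * 3) ≡ 0ℤ
  T[6n]≡0 = trans (cong thueMorseSum index) (thueMorseSum-even (n * 3))
    where index : n * 2 * 3 ≡ n * 3 * 2
          index = ℕ-Solver.solve (n ∷ [])

f30-8n+3 : ∀ n → f30 (3 + n * 8) ≡ + 3 *ℤ f30 (1 + n * 2)
f30-8n+3 n = sym (begin
  + 3 *ℤ f30 (1 + n * 2)
    ≡⟨ f30-quadruple (1 + n * 2) ⟨
  f30 ((1 + n * 2) * 4) +ℤ thueMorseSum ((1 + n * 2) * 3)
    ≡⟨ cong₂ (λ p q → f30 p +ℤ thueMorseSum q) index₄ index₃ ⟩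
  f30 (3 + n * 8) +ℤ sign (3 * (3 + n * 8)) +ℤ (thueMorseSum (2 + n * 6) +ℤ sign (2 + n * 6))
    ≡⟨ cong₂ (λ s T → f30 (3 + n * 8) +ℤ s +ℤ (T +ℤ sign (2 + n * 6))) last-sign T[6n+2]≡0 ⟩
  f30 (3 + n * 8) +ℤ - sign (2 + n * 6) +ℤ (0ℤ +ℤ sign (2 + n * 6))
    ≡⟨ cancel (f30 (3 + n * 8)) (sign (2 + n * 6)) ⟩
  f30 (3 + n * 8) ∎)
  where
  last-sign : sign (3 * (3 + n * 8)) ≡ - sign (2 + n * 6)
  last-sign = begin
    sign (3 * (3 + n * 8))             ≡⟨ cong sign index ⟩
    sign (suc ((2 + n * 6) * 2 * 2))   ≡⟨ sign-double+1 ((2 + n * 6) * 2) ⟩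
    - sign ((2 + n * 6) * 2)           ≡⟨ cong -_ (sign-double (2 + n * 6)) ⟩
    - sign (2 + n * 6)                 ∎
    where index : 3 * (3 + n * 8) ≡ suc ((2 + n * 6) * 2 * 2)
          index = ℕ-Solver.solve (n ∷ [])
  T[6n+2]≡0 : thueMorseSum (2 + n * 6) ≡ 0ℤ
  T[6n+2]≡0 = trans (cong thueMorseSum index) (thueMorseSum-even (1 + n * 3))
    where index : 2 + n * 6 ≡ (1 + n * 3) * 2
          index = ℕ-Solver.solve (n ∷ [])
  index₄ : (1 + n * 2) * 4 ≡ 4 + n * 8
  index₄ = ℕ-Solver.solve (n ∷ [])
  index₃ : (1 + n * 2) * 3 ≡ 3 + n * 6
  index₃ = ℕ-Solver.solve (n ∷ [])
  cancel : ∀ F s → F +ℤ - s +ℤ (0ℤ +ℤ s) ≡ F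
  cancel = ℤ-Solver.solve-∀

f30-2·4^i : ∀ i → f30 (2 * 4 ^ i) ≡ + (2 * 3 ^ i)
f30-2·4^i zero    = refl
f30-2·4^i (suc i) = begin
  f30 (2 * (4 * 4 ^ i))       ≡⟨ cong f30 (index (4 ^ i)) ⟩
  f30 (4 ^ i * 8)             ≡⟨ f30-8n (4 ^ i) ⟩
  + 3 *ℤ f30 (4 ^ i * 2)      ≡⟨ cong (λ m → + 3 *ℤ f30 m) (*-comm (4 ^ i) 2) ⟩
  + 3 *ℤ f30 (2 * 4 ^ i)      ≡⟨ cong (+ 3 *ℤ_) (f30-2·4^i i) ⟩
  + 3 *ℤ + (2 * 3 ^ i)        ≡⟨ pos-* 3 (2 * 3 ^ i) ⟨
  + (3 * (2 * 3 ^ i))         ≡⟨ cong +_ (value (3 ^ i)) ⟩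
  + (2 * (3 * 3 ^ i))         ∎
  where
  index : ∀ p → 2 * (4 * p) ≡ p * 8
  index = ℕ-Solver.solve-∀
  value : ∀ p → 3 * (2 * p) ≡ 2 * (3 * p)
  value = ℕ-Solver.solve-∀

-- (65·4^{i+1} + 1)/3 = 1 + 2·halfArgA i; the recursion mirrors 2m+1 ↦ 8m+3.
halfArgA : ℕ → ℕ
halfArgA zero    = 43
halfArgA (suc i) = 1 + halfArgA i * 4

65·4^[i+1]≡2+6·halfArgA : ∀ i → 65 * 4 ^ (i + 1) ≡ 2 + halfArgA i * 6
65·4^[i+1]≡2+6·halfArgA zero    = refl
65·4^[i+1]≡2+6·halfArgA (suc i) = begin
  65 * (4 * 4 ^ (i + 1))      ≡⟨ swap (4 ^ (i + 1)) ⟩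
  4 * (65 * 4 ^ (i + 1))      ≡⟨ cong (4 *_) (65·4^[i+1]≡2+6·halfArgA i) ⟩
  4 * (2 + halfArgA i * 6)    ≡⟨ step (halfArgA i) ⟩
  2 + halfArgA (suc i) * 6    ∎
  where
  swap : ∀ p → 65 * (4 * p) ≡ 4 * (65 * p)
  swap = ℕ-Solver.solve-∀
  step : ∀ h → 4 * (2 + h * 6) ≡ 2 + (1 + h * 4) * 6
  step = ℕ-Solver.solve-∀

argumentA : ∀ i → (65 * 4 ^ (i + 1) + 1) / 3 ≡ 1 + halfArgA i * 2
argumentA i = begin
  (65 * 4 ^ (i + 1) + 1) / 3       ≡⟨ cong (λ m → (m + 1) / 3) (65·4^[i+1]≡2+6·halfArgA i) ⟩
  (2 + halfArgA i * 6 + 1) / 3     ≡⟨ cong (_/ 3) (factor (halfArgA i)) ⟩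
  (1 + halfArgA i * 2) * 3 / 3     ≡⟨ m*n/n≡m (1 + halfArgA i * 2) 3 ⟩
  1 + halfArgA i * 2               ∎
  where
  factor : ∀ h → 2 + h * 6 + 1 ≡ (1 + h * 2) * 3
  factor = ℕ-Solver.solve-∀

f30-argumentA : ∀ i → f30 (1 + halfArgA i * 2) ≡ + (55 * 3 ^ i)
f30-argumentA zero    = refl
f30-argumentA (suc i) = begin
  f30 (1 + halfArgA (suc i) * 2)   ≡⟨ cong f30 (index (halfArgA i)) ⟩
  f30 (3 + halfArgA i * 8)         ≡⟨ f30-8n+3 (halfArgA i) ⟩
  + 3 *ℤ f30 (1 + halfArgA i * 2)  ≡⟨ cong (+ 3 *ℤ_) (f30-argumentA i) ⟩
  + 3 *ℤ + (55 * 3 ^ i)            ≡⟨ pos-* 3 (55 * 3 ^ i) ⟨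
  + (3 * (55 * 3 ^ i))             ≡⟨ cong +_ (value (3 ^ i)) ⟩
  + (55 * (3 * 3 ^ i))             ∎
  where
  index : ∀ h → 1 + (1 + h * 4) * 2 ≡ 3 + h * 8
  index = ℕ-Solver.solve-∀
  value : ∀ p → 3 * (55 * p) ≡ 55 * (3 * p)
  value = ℕ-Solver.solve-∀

theorem6 : (∀ (i : ℕ) → f30 ((65 * 4 ^ (i + 1) + 1) / 3) ≡ + (55 * 3 ^ i))
         × (∀ (i : ℕ) → f30 (2 * 4 ^ i) ≡ + (2 * 3 ^ i))
theorem6 = (λ i → trans (cong f30 (argumentA i)) (f30-argumentA i)) , f30-2·4^i
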